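{- If $p\ge 3$ and $n\ge 1$, then $\chi_i(S_p^n)=p$. Moreover, $S_p^n$ is perfect injectively colorable.
   Context: For integers $p\ge1$, $n\ge1$, the Sierpiński graph $S_p^n$ has vertex set $[p]^n$, where $[p]=\{1,\ldots,p\}$, and two vertices $(u_1,\ldots,u_n)$ and $(v_1,\ldots,v_n)$ are adjacent if there is an index $d\in[n]$ such that $u_i=v_i$ for $i<d$, $u_d\neq v_d$, and $v_i=u_d$ and $u_i=v_d$ for all $i\in\{d+1,\ldots,n\}$. An injective $k$-coloring of a graph $G$ is a map $f:V(G)\to\{1,\dots,k\}$ such that no vertex has two neighbors $u\neq w$ with $f(u)=f(w)$; $\chi_i(G)$ is the least such $k$. A set $B\subseteq V(G)$ is an open packing if $N(u)\cap N(v)=\emptyset$ for all distinct $u,v\in B$ (where $N(x)$ is the open neighborhood); $\rho^{\rm o}(G)$ is the maximum cardinality of an open packing. $G$ is perfect injectively colorable if it has an injective coloring in which every color class is an open packing of cardinality $\rho^{\rm o}(G)$. -}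

module Defs where

open import Level using (0ℓ)
open import Data.Nat using (ℕ; _<_; _≤_)
open import Data.Fin using (Fin; toℕ)
open import Data.Vec using (Vec; lookup)
open import Data.List using (List; length)
open import Data.List.Membership.Propositional using (_∈_)
open import Data.List.Relation.Unary.Unique.Propositional using (Unique)
open import Data.Product using (Σ; ∃; ∃-syntax; _×_)
open import Relation.Binary.PropositionalEquality using (_≡_; _≢_)
open import Relation.Nullary using (¬_)
open import Data.Empty using (⊥)
open import Function.Bundles using (_⇔_)

SVertex : ℕ → ℕ → Set
SVertex p n = Vec (Fin p) n

-- Adjacency in S_p^n, literally as in the definition (indices 0-based):
-- there is d with u_i = v_i for i < d, u_d ≠ v_d, and for all i > d,
-- v_i = u_d and u_i = v_d.
SAdj : (p n : ℕ) → SVertex p n → SVertex p n → Set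
SAdj p n u v =
  ∃[ d ] ( (∀ (i : Fin n) → toℕ i < toℕ d → lookup u i ≡ lookup v i)
         × lookup u d ≢ lookup v d
         × (∀ (i : Fin n) → toℕ d < toℕ i →
              (lookup v i ≡ lookup u d) × (lookup u i ≡ lookup v d)) )

module _ {V : Set} (Adj : V → V → Set) where

  IsInjectiveColoring : {k : ℕ} → (V → Fin k) → Set
  IsInjectiveColoring f =
    ∀ (x u w : V) → Adj x u → Adj x w → u ≢ w → f u ≢ f w

  HasInjectiveColoring : ℕ → Set
  HasInjectiveColoring k = Σ (V → Fin k) IsInjectiveColoring

  InjChromaticNumberIs : ℕ → Set
  InjChromaticNumberIs m =
    HasInjectiveColoring m × (∀ k → HasInjectiveColoring k → m ≤ k)

  IsOpenPacking : List V → Set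
  IsOpenPacking B =
    Unique B ×
    (∀ u v → u ∈ B → v ∈ B → u ≢ v → ∀ x → Adj u x → Adj v x → ⊥)

  OpenPackingNumberIs : ℕ → Set
  OpenPackingNumberIs m =
    (∃[ B ] (IsOpenPacking B × length B ≡ m)) ×
    (∀ B → IsOpenPacking B → length B ≤ m)

  IsColorClass : {k : ℕ} → (V → Fin k) → Fin k → List V → Set
  IsColorClass f c L = Unique L × (∀ v → (v ∈ L) ⇔ (f v ≡ c))

  PerfectInjectivelyColorable : Set
  PerfectInjectivelyColorable =
    ∃[ m ] ( OpenPackingNumberIs m ×
      ∃[ k ] ∃[ f ] ( IsInjectiveColoring {k} f ×
        (∀ (c : Fin k) → ∃[ L ] (IsColorClass f c L × IsOpenPacking L × length L ≡ m))))

-- Every edge of S_p^n either changes only the last letter (inside a copy of K_p) or is a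
-- bridge w a bᵏ⁺¹ — w b aᵏ⁺¹, and a vertex lies on at most one bridge. Colour a vertex by a
-- weighted sum of its letters mod p, with weights chosen so that bridges preserve it. On
-- every clique w ∷ʳ _ the colour is a translate of the last letter, hence a bijection, and
-- the bridge neighbour of w a has the colour of w a, which none of its clique neighbours
-- w b has: the colouring is injective. Conversely, w a and w b have the common neighbour
-- w t for any third letter t, so any injective colouring needs p colours and an open
-- packing contains at most one word per prefix w, i.e. at most p^(n-1) words; a colour
-- class contains exactly one word per prefix and so attains this bound.
module Submission where

open import Defs
open import Data.Nat using (ℕ; _≤_)
open import Data.Product using (_×_)

open import Data.Nat using (zero; suc; _+_; _*_; _∸_; _^_; _<_; z≤n; s≤s; s<s; NonZero)
open import Data.Nat.Properties using (+-identityʳ; +-comm; +-assoc; m+[n∸m]≡n)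
open import Data.Nat.DivMod
  using (_%_; _mod_; %-distribˡ-+; m%n%n≡m%n; [m+n]%n≡m%n; m<n⇒m%n≡m; m%n≤n)
open import Data.Nat.Tactic.RingSolver using (solve-∀)
open import Data.Fin using (Fin; toℕ; _≟_; punchIn; punchOut; combine; funToFin; finToFun)
  renaming (zero to fzero; suc to fsuc)
open import Data.Fin.Properties
  using ( toℕ-injective; toℕ-fromℕ<; toℕ<n; injective⇒≤; punchInᵢ≢i; punchIn-injective
        ; punchIn-punchOut; finToFun-funToFin; funToFin-finToFin )
open import Data.Vec using (Vec; []; _∷_; lookup; replicate; tabulate; _∷ʳ_; initLast; init; last)
open import Data.Vec.Properties
  using ( ∷-injectiveˡ; ∷-injectiveʳ; ∷ʳ-injective; ∷ʳ-injectiveˡ; ∷ʳ-injectiveʳ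
        ; lookup-replicate; tabulate-cong; tabulate∘lookup; lookup∘tabulate )
open import Data.List using (List; length; map)
  renaming (lookup to lookupᴸ; tabulate to tabulateᴸ)
open import Data.List.Properties using (length-map; length-tabulate)
open import Data.List.Membership.Propositional using (_∈_)
open import Data.List.Membership.Propositional.Properties using (∈-map⁺; ∈-map⁻; ∈-lookup; ∈-tabulate⁺)
open import Data.List.Relation.Unary.Unique.Propositional using (Unique)
import Data.List.Relation.Unary.Unique.Propositional.Properties as Unique
open import Data.List.Relation.Unary.AllPairs using (_∷_)
import Data.List.Relation.Unary.All as All
open import Data.Product using (∃-syntax; _,_; proj₁; proj₂; swap)
open import Data.Sum using (_⊎_; inj₁; inj₂)
open import Data.Empty using (⊥-elim)
open import Relation.Nullary using (yes; no)
open import Relation.Binary.PropositionalEquality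
open import Function using (_∘_)
open import Function.Bundles using (mk⇔)

private
  variable
    k m n p q : ℕ

Unique-lookup-injective : ∀ {A : Set} {xs : List A} → Unique xs →
                          ∀ i j → lookupᴸ xs i ≡ lookupᴸ xs j → i ≡ j
Unique-lookup-injective (_ ∷ _)   fzero    fzero    _  = refl
Unique-lookup-injective (x∉ ∷ _)  fzero    (fsuc j) eq = ⊥-elim (All.lookup x∉ (∈-lookup j) eq)
Unique-lookup-injective (x∉ ∷ _)  (fsuc i) fzero    eq = ⊥-elim (All.lookup x∉ (∈-lookup i) (sym eq))
Unique-lookup-injective (_ ∷ xs!) (fsuc i) (fsuc j) eq = cong fsuc (Unique-lookup-injective xs! i j eq)

avoid₂ : ∀ (i j : Fin (3 + n)) → ∃[ t ] (t ≢ i × t ≢ j)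
avoid₂ i j with i ≟ j
... | yes refl = punchIn i fzero , punchInᵢ≢i i fzero , punchInᵢ≢i i fzero
... | no i≢j   = punchIn i t′ , punchInᵢ≢i i t′ , t≢j
  where
    j′ = punchOut i≢j
    t′ = punchIn j′ fzero
    t≢j : punchIn i t′ ≢ j
    t≢j eq = punchInᵢ≢i j′ fzero (punchIn-injective i _ _ (trans eq (sym (punchIn-punchOut i≢j))))

module _ {V : Set} (Adj : V → V → Set) where

  commonNeighbours⇒colours≥ :
    ∀ {k} (g : Fin m → V) →
    (∀ {i j} → i ≢ j → g i ≢ g j × ∃[ x ] (Adj x (g i) × Adj x (g j))) →
    HasInjectiveColoring Adj k → m ≤ k
  commonNeighbours⇒colours≥ g common (f , f-inj) = injective⇒≤ f∘g-injective
    where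
      f∘g-injective : ∀ {i j} → f (g i) ≡ f (g j) → i ≡ j
      f∘g-injective {i} {j} eq with i ≟ j
      ... | yes i≡j = i≡j
      ... | no i≢j  = let gi≢gj , x , x~gi , x~gj = common i≢j
                      in ⊥-elim (f-inj x (g i) (g j) x~gi x~gj gi≢gj eq)

  commonNeighbours⇒openPacking≤ :
    ∀ {B} (π : V → Fin m) →
    (∀ {u v} → u ≢ v → π u ≡ π v → ∃[ x ] (Adj u x × Adj v x)) →
    IsOpenPacking Adj B → length B ≤ m
  commonNeighbours⇒openPacking≤ {B = B} π common (B! , packing) = injective⇒≤ π∘Unique-lookup-injective
    where
      π∘Unique-lookup-injective : ∀ {i j} → π (lookupᴸ B i) ≡ π (lookupᴸ B j) → i ≡ j
      π∘Unique-lookup-injective {i} {j} eq with i ≟ j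
      ... | yes i≡j = i≡j
      ... | no i≢j  =
        let bi≢bj = i≢j ∘ Unique-lookup-injective B! i j
            x , bi~x , bj~x = common bi≢bj eq
        in ⊥-elim (packing _ _ (∈-lookup i) (∈-lookup j) bi≢bj x bi~x bj~x)

  injectiveColoring-class-isOpenPacking :
    ∀ {k} {f : V → Fin k} {c L} →
    (∀ {u v} → Adj u v → Adj v u) → IsInjectiveColoring Adj f →
    Unique L → (∀ {v} → v ∈ L → f v ≡ c) → IsOpenPacking Adj L
  injectiveColoring-class-isOpenPacking sym-adj f-inj L! in-class =
    L! , λ u v u∈L v∈L u≢v x u~x v~x →
      f-inj x u v (sym-adj u~x) (sym-adj v~x) u≢v (trans (in-class u∈L) (sym (in-class v∈L)))

≗⇒≡ : ∀ {A : Set} {u v : Vec A n} → (∀ i → lookup u i ≡ lookup v i) → u ≡ v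
≗⇒≡ {u = u} {v} eq = trans (sym (tabulate∘lookup u)) (trans (tabulate-cong eq) (tabulate∘lookup v))

funToFin-cong : {f g : Fin m → Fin p} → (∀ i → f i ≡ g i) → funToFin f ≡ funToFin g
funToFin-cong {zero}  eq = refl
funToFin-cong {suc m} eq = cong₂ combine (eq fzero) (funToFin-cong (eq ∘ fsuc))

module _ {p : ℕ} where

  wordToFin : Vec (Fin p) m → Fin (p ^ m)
  wordToFin w = funToFin (lookup w)

  finToWord : Fin (p ^ m) → Vec (Fin p) m
  finToWord i = tabulate (finToFun i)

  finToWord-wordToFin : ∀ (w : Vec (Fin p) m) → finToWord {m} (wordToFin w) ≡ w
  finToWord-wordToFin w = trans (tabulate-cong (finToFun-funToFin (lookup w))) (tabulate∘lookup w)

  wordToFin-finToWord : ∀ (i : Fin (p ^ m)) → wordToFin (finToWord {m} i) ≡ i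
  wordToFin-finToWord {m} i =
    trans (funToFin-cong (lookup∘tabulate (finToFun {p} {m} i))) (funToFin-finToFin {m} i)

  wordToFin-injective : ∀ {v w : Vec (Fin p) m} → wordToFin v ≡ wordToFin w → v ≡ w
  wordToFin-injective {m} {v} {w} eq =
    trans (sym (finToWord-wordToFin v)) (trans (cong (finToWord {m}) eq) (finToWord-wordToFin w))

  finToWord-injective : ∀ {i j : Fin (p ^ m)} → finToWord {m} i ≡ finToWord j → i ≡ j
  finToWord-injective {m} {i} {j} eq =
    trans (sym (wordToFin-finToWord {m} i)) (trans (cong wordToFin eq) (wordToFin-finToWord {m} j))

  allWords : ∀ m → List (Vec (Fin p) m)
  allWords m = tabulateᴸ (finToWord {m})

  allWords-unique : ∀ m → Unique (allWords m)
  allWords-unique m = Unique.tabulate⁺ (finToWord-injective {m})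

  ∈-allWords : ∀ (w : Vec (Fin p) m) → w ∈ allWords m
  ∈-allWords w = subst (_∈ allWords _) (finToWord-wordToFin w) (∈-tabulate⁺ (wordToFin w))

  length-allWords : ∀ m → length (allWords m) ≡ p ^ m
  length-allWords m = length-tabulate (finToWord {m})

AdjAt : Fin n → SVertex p n → SVertex p n → Set
AdjAt {n} d u v =
  (∀ (i : Fin n) → toℕ i < toℕ d → lookup u i ≡ lookup v i)
  × lookup u d ≢ lookup v d
  × (∀ (i : Fin n) → toℕ d < toℕ i → (lookup v i ≡ lookup u d) × (lookup u i ≡ lookup v d))

SAdj-sym : ∀ {u v : SVertex p n} → SAdj p n u v → SAdj p n v u
SAdj-sym (d , agree , differ , swapped) =
  d , (λ i i<d → sym (agree i i<d)) , (λ eq → differ (sym eq)) , (λ i d<i → swap (swapped i d<i))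

AdjAt-∷ : ∀ {d : Fin n} {x} {u v : SVertex p n} → AdjAt d u v → AdjAt (fsuc d) (x ∷ u) (x ∷ v)
AdjAt-∷ {d = d} {x} {u} {v} (agree , differ , swapped) = agree′ , differ , swapped′
  where
    agree′ : ∀ i → toℕ i < suc (toℕ d) → lookup (x ∷ u) i ≡ lookup (x ∷ v) i
    agree′ fzero    _         = refl
    agree′ (fsuc i) (s<s i<d) = agree i i<d
    swapped′ : ∀ i → suc (toℕ d) < toℕ i →
               (lookup (x ∷ v) i ≡ lookup u d) × (lookup (x ∷ u) i ≡ lookup v d)
    swapped′ (fsuc i) (s<s d<i) = swapped i d<i

AdjAt-∷⁻ : ∀ {d : Fin n} {x y} {u v : SVertex p n} →
           AdjAt (fsuc d) (x ∷ u) (y ∷ v) → x ≡ y × AdjAt d u v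
AdjAt-∷⁻ (agree , differ , swapped) =
  agree fzero (s<s z≤n) , (λ i i<d → agree (fsuc i) (s<s i<d)) , differ , (λ i d<i → swapped (fsuc i) (s<s d<i))

AdjAt-zero⁻ : ∀ {a b} {u v : SVertex p n} → AdjAt fzero (a ∷ u) (b ∷ v) →
              a ≢ b × u ≡ replicate n b × v ≡ replicate n a
AdjAt-zero⁻ {a = a} {b} (_ , differ , swapped) =
  differ ,
  ≗⇒≡ (λ i → trans (proj₂ (swapped (fsuc i) (s<s z≤n))) (sym (lookup-replicate i b))) ,
  ≗⇒≡ (λ i → trans (proj₁ (swapped (fsuc i) (s<s z≤n))) (sym (lookup-replicate i a)))

∷ʳ-adjacent : ∀ (w : SVertex p m) {a b} → a ≢ b → SAdj p (suc m) (w ∷ʳ a) (w ∷ʳ b)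
∷ʳ-adjacent []      a≢b = fzero , (λ _ ()) , a≢b , λ { fzero () }
∷ʳ-adjacent (x ∷ w) a≢b = let d , adj = ∷ʳ-adjacent w a≢b in fsuc d , AdjAt-∷ adj

data CliqueEdge {p m} (u v : SVertex p (suc m)) : Set where
  clique : ∀ w {a b} → a ≢ b → u ≡ w ∷ʳ a → v ≡ w ∷ʳ b → CliqueEdge u v

data BridgeEdge {p} : ∀ {n} → SVertex p n → SVertex p n → Set where
  bridge   : ∀ {k a b} {u v : SVertex p (suc k)} → a ≢ b →
             u ≡ replicate (suc k) b → v ≡ replicate (suc k) a → BridgeEdge (a ∷ u) (b ∷ v)
  ∷-bridge : ∀ {n x} {u v : SVertex p n} → BridgeEdge u v → BridgeEdge (x ∷ u) (x ∷ v)

classify : ∀ {u v : SVertex p (suc m)} → SAdj p (suc m) u v → CliqueEdge u v ⊎ BridgeEdge u v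
classify {m = zero}  {u = _ ∷ []} {_ ∷ []} (fzero , adj) = inj₁ (clique [] (proj₁ (AdjAt-zero⁻ adj)) refl refl)
classify {m = suc _} {u = _ ∷ _}  {_ ∷ _}  (fzero , adj) =
  let a≢b , u≡bᵏ , v≡aᵏ = AdjAt-zero⁻ adj in inj₂ (bridge a≢b u≡bᵏ v≡aᵏ)
classify {m = suc _} {u = x ∷ u}  {_ ∷ v}  (fsuc d , adj) with AdjAt-∷⁻ adj
... | refl , adj′ with classify {u = u} {v} (d , adj′)
...   | inj₁ (clique w a≢b refl refl) = inj₁ (clique (x ∷ w) a≢b refl refl)
...   | inj₂ e                        = inj₂ (∷-bridge e)

bridge-source-nonconstant : ∀ {u v : SVertex p n} {c} → BridgeEdge u v → u ≢ replicate n c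
bridge-source-nonconstant (bridge a≢b refl _) eq =
  a≢b (trans (∷-injectiveˡ eq) (sym (∷-injectiveˡ (∷-injectiveʳ eq))))
bridge-source-nonconstant (∷-bridge e) eq = bridge-source-nonconstant e (∷-injectiveʳ eq)

bridge-unique : ∀ {x u v : SVertex p n} → BridgeEdge x u → BridgeEdge x v → u ≡ v
bridge-unique (bridge _ refl refl) (bridge _ bᵏ≡b′ᵏ refl) = cong (_∷ _) (∷-injectiveˡ bᵏ≡b′ᵏ)
bridge-unique (bridge _ refl _)    (∷-bridge e)          = ⊥-elim (bridge-source-nonconstant e refl)
bridge-unique (∷-bridge e)         (bridge _ refl _)     = ⊥-elim (bridge-source-nonconstant e refl)
bridge-unique (∷-bridge e)         (∷-bridge e′)         = cong (_ ∷_) (bridge-unique e e′)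

-- weight (1 + j) = weight 0 + ⋯ + weight j, so a bridge, which trades a ∷ bʲ⁺¹
-- for b ∷ aʲ⁺¹, does not change the weighted sum.
weight : ℕ → ℕ
weight zero    = 1
weight (suc j) = 2 ^ j

weightedSum : SVertex p n → ℕ
weightedSum             []      = 0
weightedSum {n = suc n} (a ∷ u) = weight n * toℕ a + weightedSum u

weightedSum-replicate : ∀ k (b : Fin p) → weightedSum (replicate (suc k) b) ≡ weight (suc k) * toℕ b
weightedSum-replicate zero    b = +-identityʳ _
weightedSum-replicate (suc k) b =
  trans (cong (2 ^ k * toℕ b +_) (weightedSum-replicate k b)) (double (2 ^ k) (toℕ b))
  where
    double : ∀ x y → x * y + x * y ≡ (2 * x) * y
    double = solve-∀

bridge-preserves-weightedSum : ∀ {u v : SVertex p n} → BridgeEdge u v → weightedSum u ≡ weightedSum v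
bridge-preserves-weightedSum (bridge {k} {a} {b} _ refl refl)
  rewrite weightedSum-replicate k b | weightedSum-replicate k a = +-comm (weight (suc k) * toℕ a) _
bridge-preserves-weightedSum {n = suc n} (∷-bridge {x = x} e) =
  cong (weight n * toℕ x +_) (bridge-preserves-weightedSum e)

prefixWeight : SVertex p m → ℕ
prefixWeight             []      = 0
prefixWeight {m = suc m} (a ∷ w) = weight (suc m) * toℕ a + prefixWeight w

weightedSum-∷ʳ : ∀ (w : SVertex p m) a → weightedSum (w ∷ʳ a) ≡ prefixWeight w + toℕ a
weightedSum-∷ʳ []      a = trans (+-identityʳ _) (+-identityʳ _)
weightedSum-∷ʳ {m = suc m} (x ∷ w) a =
  trans (cong (weight (suc m) * toℕ x +_) (weightedSum-∷ʳ w a)) (sym (+-assoc _ (prefixWeight w) (toℕ a)))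

module _ (d : ℕ) .{{_ : NonZero d}} where

  [m%d+n]%d≡[m+n]%d : ∀ m n → (m % d + n) % d ≡ (m + n) % d
  [m%d+n]%d≡[m+n]%d m n = begin
    (m % d + n) % d          ≡⟨ %-distribˡ-+ (m % d) n d ⟩
    (m % d % d + n % d) % d  ≡⟨ cong (λ r → (r + n % d) % d) (m%n%n≡m%n m d) ⟩
    (m % d + n % d) % d      ≡⟨ %-distribˡ-+ m n d ⟨
    (m + n) % d              ∎
    where open ≡-Reasoning

  [m+n%d]%d≡[m+n]%d : ∀ m n → (m + n % d) % d ≡ (m + n) % d
  [m+n%d]%d≡[m+n]%d m n = begin
    (m + n % d) % d  ≡⟨ cong (_% d) (+-comm m (n % d)) ⟩
    (n % d + m) % d  ≡⟨ [m%d+n]%d≡[m+n]%d n m ⟩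
    (n + m) % d      ≡⟨ cong (_% d) (+-comm n m) ⟩
    (m + n) % d      ∎
    where open ≡-Reasoning

  [g+[n+[d∸g%d]]]%d≡n%d : ∀ g n → (g + (n + (d ∸ g % d))) % d ≡ n % d
  [g+[n+[d∸g%d]]]%d≡n%d g n = begin
    (g + (n + (d ∸ r))) % d      ≡⟨ [m%d+n]%d≡[m+n]%d g _ ⟨
    (r + (n + (d ∸ r))) % d      ≡⟨ cong (_% d) (swap-left r n (d ∸ r)) ⟩
    (n + (r + (d ∸ r))) % d      ≡⟨ cong (λ s → (n + s) % d) (m+[n∸m]≡n (m%n≤n g d)) ⟩
    (n + d) % d                  ≡⟨ [m+n]%n≡m%n n d ⟩
    n % d                        ∎
    where
      open ≡-Reasoning
      r = g % d
      swap-left : ∀ x y z → x + (y + z) ≡ y + (x + z)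
      swap-left = solve-∀

module _ {d : ℕ} .{{_ : NonZero d}} where

  toℕ-mod : ∀ m → toℕ (m mod d) ≡ m % d
  toℕ-mod m = toℕ-fromℕ< _

  shift : ℕ → Fin d → Fin d
  shift g a = (g + toℕ a) mod d

  unshift : ℕ → Fin d → Fin d
  unshift g c = (toℕ c + (d ∸ g % d)) mod d

  unshift-shift : ∀ g a → unshift g (shift g a) ≡ a
  unshift-shift g a = toℕ-injective (begin
    toℕ (unshift g (shift g a))           ≡⟨ toℕ-mod _ ⟩
    (toℕ (shift g a) + (d ∸ g % d)) % d   ≡⟨ cong (λ x → (x + (d ∸ g % d)) % d) (toℕ-mod _) ⟩
    ((g + toℕ a) % d + (d ∸ g % d)) % d   ≡⟨ [m%d+n]%d≡[m+n]%d d (g + toℕ a) _ ⟩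
    (g + toℕ a + (d ∸ g % d)) % d         ≡⟨ cong (_% d) (+-assoc g (toℕ a) _) ⟩
    (g + (toℕ a + (d ∸ g % d))) % d       ≡⟨ [g+[n+[d∸g%d]]]%d≡n%d d g (toℕ a) ⟩
    toℕ a % d                             ≡⟨ m<n⇒m%n≡m (toℕ<n a) ⟩
    toℕ a                                 ∎)
    where open ≡-Reasoning

  shift-unshift : ∀ g c → shift g (unshift g c) ≡ c
  shift-unshift g c = toℕ-injective (begin
    toℕ (shift g (unshift g c))           ≡⟨ toℕ-mod _ ⟩
    (g + toℕ (unshift g c)) % d           ≡⟨ cong (λ x → (g + x) % d) (toℕ-mod _) ⟩
    (g + (toℕ c + (d ∸ g % d)) % d) % d   ≡⟨ [m+n%d]%d≡[m+n]%d d g _ ⟩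
    (g + (toℕ c + (d ∸ g % d))) % d       ≡⟨ [g+[n+[d∸g%d]]]%d≡n%d d g (toℕ c) ⟩
    toℕ c % d                             ≡⟨ m<n⇒m%n≡m (toℕ<n c) ⟩
    toℕ c                                 ∎)
    where open ≡-Reasoning

module _ {p : ℕ} .{{_ : NonZero p}} where

  colour : SVertex p n → Fin p
  colour u = weightedSum u mod p

  colour-∷ʳ : ∀ (w : SVertex p m) a → colour (w ∷ʳ a) ≡ shift (prefixWeight w) a
  colour-∷ʳ w a = cong (_mod p) (weightedSum-∷ʳ w a)

  colour-∷ʳ-injective : ∀ (w : SVertex p m) {a b} → colour (w ∷ʳ a) ≡ colour (w ∷ʳ b) → a ≡ b
  colour-∷ʳ-injective w {a} {b} eq = begin
    a                          ≡⟨ unshift-shift g a ⟨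
    unshift g (shift g a)      ≡⟨ cong (unshift g) (trans (sym (colour-∷ʳ w a)) (trans eq (colour-∷ʳ w b))) ⟩
    unshift g (shift g b)      ≡⟨ unshift-shift g b ⟩
    b                          ∎
    where
      open ≡-Reasoning
      g = prefixWeight w

  bridge-preserves-colour : ∀ {u v : SVertex p n} → BridgeEdge u v → colour u ≡ colour v
  bridge-preserves-colour e = cong (_mod p) (bridge-preserves-weightedSum e)

  clique-bridge-colours-differ : ∀ {x u v : SVertex p (suc m)} → CliqueEdge x u → BridgeEdge x v →
                                 colour u ≢ colour v
  clique-bridge-colours-differ (clique w a≢b refl refl) e eq =
    a≢b (colour-∷ʳ-injective w (trans (bridge-preserves-colour e) (sym eq)))

  colour-injective-on-neighbours :
    ∀ {x u v : SVertex p (suc m)} → CliqueEdge x u ⊎ BridgeEdge x u → CliqueEdge x v ⊎ BridgeEdge x v →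
    colour u ≡ colour v → u ≡ v
  colour-injective-on-neighbours (inj₁ (clique w _ refl refl)) (inj₁ (clique w′ _ x≡w′a′ refl)) eq
    with refl , refl ← ∷ʳ-injective w w′ x≡w′a′ = cong (w ∷ʳ_) (colour-∷ʳ-injective w eq)
  colour-injective-on-neighbours (inj₁ c) (inj₂ e)  eq = ⊥-elim (clique-bridge-colours-differ c e eq)
  colour-injective-on-neighbours (inj₂ e) (inj₁ c)  eq = ⊥-elim (clique-bridge-colours-differ c e (sym eq))
  colour-injective-on-neighbours (inj₂ e) (inj₂ e′) _  = bridge-unique e e′

  colour-isInjectiveColoring : IsInjectiveColoring (SAdj p (suc m)) colour
  colour-isInjectiveColoring x u v x~u x~v u≢v eq =
    u≢v (colour-injective-on-neighbours (classify {u = x} {u} x~u) (classify {u = x} {v} x~v) eq)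

  lastLetterFor : SVertex p m → Fin p → Fin p
  lastLetterFor w c = unshift (prefixWeight w) c

  colourClass : ∀ m → Fin p → List (SVertex p (suc m))
  colourClass m c = map (λ w → w ∷ʳ lastLetterFor w c) (allWords m)

  colourClass-unique : ∀ m c → Unique (colourClass m c)
  colourClass-unique m c = Unique.map⁺ (λ {w} {w′} → ∷ʳ-injectiveˡ w w′) (allWords-unique m)

  length-colourClass : ∀ m c → length (colourClass m c) ≡ p ^ m
  length-colourClass m c = trans (length-map _ (allWords m)) (length-allWords m)

  ∈-colourClass⁻ : ∀ {c} {v : SVertex p (suc m)} → v ∈ colourClass m c → colour v ≡ c
  ∈-colourClass⁻ {c = c} v∈ with w , _ , refl ← ∈-map⁻ _ v∈ =
    trans (colour-∷ʳ w _) (shift-unshift (prefixWeight w) c)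

  ∈-colourClass⁺ : ∀ {c} {v : SVertex p (suc m)} → colour v ≡ c → v ∈ colourClass m c
  ∈-colourClass⁺ {m} {c} {v} eq with initLast v
  ... | w , a , refl = subst (_∈ colourClass m c) (cong (w ∷ʳ_) lastLetter≡a) (∈-map⁺ _ (∈-allWords w))
    where
      open ≡-Reasoning
      g = prefixWeight w
      lastLetter≡a : lastLetterFor w c ≡ a
      lastLetter≡a = begin
        unshift g c            ≡⟨ cong (unshift g) eq ⟨
        unshift g (colour v)   ≡⟨ cong (unshift g) (colour-∷ʳ w a) ⟩
        unshift g (shift g a)  ≡⟨ unshift-shift g a ⟩
        a                      ∎

  colourClass-isColorClass : ∀ m c → IsColorClass (SAdj p (suc m)) colour c (colourClass m c)
  colourClass-isColorClass m c = colourClass-unique m c , λ _ → mk⇔ ∈-colourClass⁻ ∈-colourClass⁺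

  colourClass-isOpenPacking : ∀ m c → IsOpenPacking (SAdj p (suc m)) (colourClass m c)
  colourClass-isOpenPacking m c = injectiveColoring-class-isOpenPacking _
    (λ {u} {v} → SAdj-sym {u = u} {v}) colour-isInjectiveColoring (colourClass-unique m c) (∈-colourClass⁻ {m})

init-∷ʳ-last : ∀ {A : Set} (u : Vec A (suc n)) → u ≡ init u ∷ʳ last u
init-∷ʳ-last u = proj₂ (proj₂ (initLast u))

∷ʳ-commonNeighbour : ∀ (w : SVertex (3 + q) m) a b →
                     ∃[ x ] (SAdj (3 + q) (suc m) (w ∷ʳ a) x × SAdj (3 + q) (suc m) (w ∷ʳ b) x)
∷ʳ-commonNeighbour w a b =
  let t , t≢a , t≢b = avoid₂ a b in w ∷ʳ t , ∷ʳ-adjacent w (t≢a ∘ sym) , ∷ʳ-adjacent w (t≢b ∘ sym)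

SAdj-colours≥ : HasInjectiveColoring (SAdj (3 + q) (suc m)) k → 3 + q ≤ k
SAdj-colours≥ {q} {m} = commonNeighbours⇒colours≥ _ (w₀ ∷ʳ_) common
  where
    w₀ = replicate m fzero
    common : ∀ {i j} → i ≢ j →
             w₀ ∷ʳ i ≢ w₀ ∷ʳ j × ∃[ x ] (SAdj (3 + q) (suc m) x (w₀ ∷ʳ i) × SAdj (3 + q) (suc m) x (w₀ ∷ʳ j))
    common {i} {j} i≢j =
      let x , i~x , j~x = ∷ʳ-commonNeighbour w₀ i j
      in i≢j ∘ ∷ʳ-injectiveʳ w₀ w₀ , x , SAdj-sym {u = w₀ ∷ʳ i} {x} i~x , SAdj-sym {u = w₀ ∷ʳ j} {x} j~x

SAdj-openPacking≤ : ∀ {B} → IsOpenPacking (SAdj (3 + q) (suc m)) B → length B ≤ (3 + q) ^ m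
SAdj-openPacking≤ {q} {m} = commonNeighbours⇒openPacking≤ _ (wordToFin ∘ init) common
  where
    common : ∀ {u v : SVertex (3 + q) (suc m)} → u ≢ v → wordToFin (init u) ≡ wordToFin (init v) →
             ∃[ x ] (SAdj (3 + q) (suc m) u x × SAdj (3 + q) (suc m) v x)
    common {u} {v} _ eq =
      subst₂ (λ u′ v′ → ∃[ x ] (SAdj (3 + q) (suc m) u′ x × SAdj (3 + q) (suc m) v′ x))
        (sym (init-∷ʳ-last u))
        (sym (trans (init-∷ʳ-last v) (cong (_∷ʳ last v) (sym (wordToFin-injective {v = init u} {init v} eq)))))
        (∷ʳ-commonNeighbour (init u) (last u) (last v))

SAdj-injChromaticNumber : InjChromaticNumberIs (SAdj (3 + q) (suc m)) (3 + q)
SAdj-injChromaticNumber = (colour , colour-isInjectiveColoring) , λ _ → SAdj-colours≥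

SAdj-openPackingNumber : OpenPackingNumberIs (SAdj (3 + q) (suc m)) ((3 + q) ^ m)
SAdj-openPackingNumber {q} {m} =
  (colourClass m fzero , colourClass-isOpenPacking m fzero , length-colourClass m fzero) , λ _ → SAdj-openPacking≤

theorem3p1 : ∀ (p n : ℕ) → 3 ≤ p → 1 ≤ n →
    InjChromaticNumberIs (SAdj p n) p × PerfectInjectivelyColorable (SAdj p n)
theorem3p1 (suc (suc (suc q))) (suc m) _ _ =
  SAdj-injChromaticNumber ,
  ( _ , SAdj-openPackingNumber , _ , colour , colour-isInjectiveColoring
  , λ c → colourClass m c
        , colourClass-isColorClass m c
        , colourClass-isOpenPacking m c
        , length-colourClass m c )
theorem3p1 0                   _ ()             _
theorem3p1 1                   _ (s≤s ())       _
theorem3p1 2                   _ (s≤s (s≤s ())) _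
theorem3p1 (suc (suc (suc _))) 0 _              ()
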